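{- Let $\alpha$ be a monoid morphism from $\Omega_n^*$ to the multiplicative monoid of an idempotent semiring $R$ such that for some $b_0,b_1\in B$, $\alpha(w)\cdot b_0\ge b_1$ iff $w$ is balanced (i.e. $w\in\mathcal{D}_n$). Suppose also that $b_1$ has the property that for any $c_1,c_2\in B$, if $c_1+c_2\ge b_1$ then $c_1\ge b_1$ or $c_2\ge b_1$. Then for any context-free language $\mathcal{L}\subseteq A^*$ there is a $\mathbb{T}_R$-automaton recognizing $\mathcal{L}$ by $b_1$.
   Context: $A$ is a finite input alphabet. $R$ is a semiring finitely generated by $R_0$, $B$ an $R$-semimodule finitely generated by $B_0$, and $\mathbb{T}_R$ is the semimodule monad: $T_RX$ is the free $R$-semimodule on $X$ (finitely supported maps $X\to R$, i.e. formal sums $r_1\cdot x_1+\cdots+r_k\cdot x_k$). When $R$ is idempotent, $B$ is partially ordered by $b\le c$ iff $b+c=c$. A $\mathbb{T}_R$-automaton $m$ consists of a finite set $X$, maps $o^m:X\to B$, $t^m:A\times X\to T_RX$ and the $\mathbb{T}_R$-algebra structure $a^m:T_RB\to B$ of the semimodule $B$; its trace semantics $[\![x]\!]_m:A^*\to B$ is obtained by the generalized powerset construction (the unique $\mathbb{T}_R$-algebra morphism $T_RX\to B\times(T_RX)^A$ extending $\langle o^m,t^m\rangle$ along $\eta$, followed by the unique coalgebra morphism into the final $B\times(-)^A$-coalgebra $B^{A^*}$). A $\mathbb{T}_R$-automaton recognizes $\mathcal{L}$ by $b\in B$ if $\mathcal{L}=\{w\in A^*\mid [\![x_0]\!]_m(w)\ge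 b\}$ for some state $x_0$. $\Omega_n=\{(_1,)_1,\dots,(_n,)_n\}$ and $\mathcal{D}_n\subseteq\Omega_n^*$ is the Dyck language of balanced parentheses. -}

module Defs where

open import Level using (Level; _⊔_)
open import Data.Nat using (ℕ; zero; suc)
open import Data.Fin using (Fin; zero; suc)
open import Data.List using (List; []; _∷_; _++_)
open import Data.List.Membership.Propositional using (_∈_)
open import Data.Sum using (_⊎_; inj₁; inj₂)
open import Data.Product using (_×_; _,_; Σ; ∃)
open import Function.Bundles using (_⇔_)
open import Relation.Binary.PropositionalEquality using (_≡_)
open import Algebra.Bundles using (Semiring)
open import Algebra.Module.Bundles using (LeftSemimodule)

module _ {c ℓ : Level} (R : Semiring c ℓ) where
  open Semiring R using (Carrier; _≈_; _+_; _*_; 0#; 1#)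

  Idempotent : Set (c ⊔ ℓ)
  Idempotent = ∀ r → (r + r) ≈ r

  data InSubsemiring (R₀ : List Carrier) : Carrier → Set (c ⊔ ℓ) where
    gen  : ∀ {r} → r ∈ R₀ → InSubsemiring R₀ r
    zro  : InSubsemiring R₀ 0#
    one  : InSubsemiring R₀ 1#
    add  : ∀ {r s} → InSubsemiring R₀ r → InSubsemiring R₀ s → InSubsemiring R₀ (r + s)
    mul  : ∀ {r s} → InSubsemiring R₀ r → InSubsemiring R₀ s → InSubsemiring R₀ (r * s)
    resp : ∀ {r s} → r ≈ s → InSubsemiring R₀ r → InSubsemiring R₀ s

  FinitelyGeneratedSemiring : Set (c ⊔ ℓ)
  FinitelyGeneratedSemiring = Σ (List Carrier) λ R₀ → ∀ r → InSubsemiring R₀ r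

  record MonoidMorphism (S : Set) : Set (c ⊔ ℓ) where
    field
      α      : List S → Carrier
      α-ε    : α [] ≈ 1#
      α-++   : ∀ u v → α (u ++ v) ≈ (α u * α v)

module _ {c ℓ m ℓm : Level} {R : Semiring c ℓ} (B : LeftSemimodule R m ℓm) where
  open Semiring R using (Carrier)
  open LeftSemimodule B

  data InSubmodule (B₀ : List Carrierᴹ) : Carrierᴹ → Set (c ⊔ m ⊔ ℓm) where
    gen  : ∀ {b} → b ∈ B₀ → InSubmodule B₀ b
    zro  : InSubmodule B₀ 0ᴹ
    add  : ∀ {b d} → InSubmodule B₀ b → InSubmodule B₀ d → InSubmodule B₀ (b +ᴹ d)
    scl  : ∀ r {b} → InSubmodule B₀ b → InSubmodule B₀ (r *ₗ b)
    resp : ∀ {b d} → b ≈ᴹ d → InSubmodule B₀ b → InSubmodule B₀ d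

  FinitelyGeneratedModule : Set (c ⊔ m ⊔ ℓm)
  FinitelyGeneratedModule = Σ (List Carrierᴹ) λ B₀ → ∀ b → InSubmodule B₀ b

  -- the order on B (meaningful when R is idempotent): b ≤ c iff b + c = c
  _≤ᴮ_ : Carrierᴹ → Carrierᴹ → Set ℓm
  b ≤ᴮ d = (b +ᴹ d) ≈ᴹ d

  PrimeElement : Carrierᴹ → Set (m ⊔ ℓm)
  PrimeElement b = ∀ c₁ c₂ → b ≤ᴮ (c₁ +ᴹ c₂) → (b ≤ᴮ c₁) ⊎ (b ≤ᴮ c₂)

  Σᴹ : ∀ {k} → (Fin k → Carrierᴹ) → Carrierᴹ
  Σᴹ {zero}  f = 0ᴹ
  Σᴹ {suc k} f = f zero +ᴹ Σᴹ (λ i → f (suc i))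

  -- A T_R-automaton over the finite alphabet A with state set Fin k:
  -- output o : X → B, transitions t : A × X → T_R X, where an element of
  -- T_R X (X finite) is a map X → R.  The algebra structure on B is the
  -- semimodule structure of B.
  record Automaton (A : Set) (k : ℕ) : Set (c ⊔ m) where
    field
      out   : Fin k → Carrierᴹ
      trans : A → Fin k → Fin k → Carrier

  -- trace semantics obtained by the generalized powerset construction:
  --   [[x]](ε)   = o(x)
  --   [[x]](a w) = Σ_y t(a,x)(y) · [[y]](w)
  trace : ∀ {A k} → Automaton A k → Fin k → List A → Carrierᴹ
  trace M x []      = Automaton.out M x
  trace M x (a ∷ w) = Σᴹ (λ y → Automaton.trans M a x y *ₗ trace M y w)

  RecognizesBy : ∀ {A k} → Automaton A k → (List A → Set) → Carrierᴹ → Set ℓm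
  RecognizesBy {k = k} M L b =
    Σ (Fin k) λ x₀ → ∀ w → L w ⇔ (b ≤ᴮ trace M x₀ w)

-- Dyck language over Ω_n: inj₁ i is the opening bracket (_i, inj₂ i is )_i

Ω : ℕ → Set
Ω n = Fin n ⊎ Fin n

data Dyck {n : ℕ} : List (Ω n) → Set where
  ε    : Dyck []
  nest : ∀ i {w} → Dyck w → Dyck (inj₁ i ∷ w ++ inj₂ i ∷ [])
  cat  : ∀ {u v} → Dyck u → Dyck v → Dyck (u ++ v)

record CFG (A : Set) : Set₁ where
  field
    N     : ℕ
    start : Fin N
    rules : List (Fin N × List (A ⊎ Fin N))

module _ {A : Set} (G : CFG A) where
  open CFG G
  mutual
    data Derives : Fin N → List A → Set where
      rule : ∀ {X rhs w} → (X , rhs) ∈ rules → DerivesSeq rhs w → Derives X w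
    data DerivesSeq : List (A ⊎ Fin N) → List A → Set where
      []ᵈ  : DerivesSeq [] []
      term : ∀ a {s w} → DerivesSeq s w → DerivesSeq (inj₁ a ∷ s) (a ∷ w)
      nont : ∀ {X s u v} → Derives X u → DerivesSeq s v → DerivesSeq (inj₂ X ∷ s) (u ++ v)

  Language : List A → Set
  Language w = Derives start w

ContextFree : {A : Set} → (List A → Set) → Set₁
ContextFree {A} L = Σ (CFG A) λ G → ∀ w → L w ⇔ Language G w

-- A context-free language is a finite-state transduction of a Dyck language
-- (Chomsky–Schützenberger). After binarising the grammar, a word is read leaf by leaf;
-- each leaf, together with the branch that joins it to the next leaf, emits brackets
-- pushing and popping the pending and finished subtrees of a parse tree, so the word is
-- generated iff one of its emissions is balanced. The many bracket types needed are
-- coded by two of the n available ones.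
-- Weighting each transition by the sum of α over the words it may emit gives a
-- T_R-automaton with [[x₀]](w) = Σ α(u)·b₀ over the emissions u of w. As b₁ is prime
-- (and nonzero, since a lone closing bracket is unbalanced), b₁ ≤ [[x₀]](w) iff
-- b₁ ≤ α(u)·b₀ for some emission u, that is, iff some emission is balanced.

module Submission where

open import Defs
open import Level using (Level)
open import Data.Nat using (ℕ; zero; suc; _≤_; _<_; s≤s; z≤n)
open import Data.Nat.Properties using (suc-injective; m≤n⇒m≤1+n) renaming (_≟_ to _≟ℕ_)
open import Data.Nat.Induction using (<-wellFounded)
open import Induction.WellFounded using (Acc; acc)
open import Data.Fin using (Fin; zero; suc; toℕ)
open import Data.Fin.Properties using (toℕ-injective) renaming (_≟_ to _≟Fin_)
open import Data.List
  using (List; []; _∷_; _++_; map; foldr; concatMap; length; replicate; drop; upTo; allFin; lookup;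
         filter; cartesianProductWith; cartesianProduct)
open import Data.List.Properties using (++-assoc; ++-identityʳ; ∷-injective; ≡-dec; concatMap-++)
open import Data.List.Membership.Propositional using (_∈_; _∉_; find; lose)
open import Data.List.Membership.Propositional.Properties
  using (∈-map⁺; ∈-map⁻; ∈-++⁺ˡ; ∈-++⁺ʳ; ∈-++⁻; ∈-allFin; ∈-upTo⁺; ∈-lookup; ∈-concatMap⁺; ∈-concatMap⁻;
         ∈-filter⁺; ∈-filter⁻; ∈-cartesianProductWith⁺; ∈-cartesianProductWith⁻; ∈-cartesianProduct⁺)
open import Data.List.Relation.Unary.Any using (here; there; any?; index)
open import Data.List.Relation.Unary.Any.Properties using (lookup-index)
open import Data.List.Relation.Unary.All using (All; []; _∷_; all?)
import Data.List.Relation.Unary.All as All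
import Data.List.Relation.Unary.All.Properties as AllP
open import Data.Maybe using (Maybe; just; nothing; _>>=_)
import Data.Maybe as Maybe
open import Data.Maybe.Properties using (just-injective)
open import Data.Sum using (_⊎_; inj₁; inj₂)
open import Data.Sum.Properties using () renaming (≡-dec to ≡-dec-⊎)
open import Data.Product using (Σ; _×_; _,_; ∃; ∃₂; proj₁; proj₂)
open import Data.Product.Properties using () renaming (≡-dec to ≡-dec-×)
open import Data.Empty using (⊥)
open import Function.Bundles using (_⇔_; mk⇔; Equivalence)
open import Function.Properties.Equivalence using () renaming (trans to ⇔-trans; sym to ⇔-sym)
open import Relation.Binary.Definitions using (DecidableEquality)
open import Relation.Binary.PropositionalEquality using (_≡_; _≢_; refl; sym; trans; cong; cong₂; subst)
open import Relation.Nullary using (Dec; yes; no; ¬_; contradiction)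
open import Relation.Nullary.Decidable using (map′; ¬?; _×-dec_; decidable-stable)
open import Algebra.Bundles using (Semiring)
open import Algebra.Module.Bundles using (LeftSemimodule)
import Relation.Binary.Reasoning.Setoid as SetoidReasoning

-- Dyck words and their recognition by a stack

pattern push i = inj₁ i
pattern pop  i = inj₂ i

module StackMachine {S : Set} (_≟_ : DecidableEquality S) where

  run : List (S ⊎ S) → List S → Maybe (List S)
  run []           st       = just st
  run (push i ∷ w) st       = run w (i ∷ st)
  run (pop i ∷ w) []       = nothing
  run (pop i ∷ w) (j ∷ st) with i ≟ j
  ... | yes _ = run w st
  ... | no  _ = nothing

  run-++ : ∀ u v st → run (u ++ v) st ≡ (run u st >>= run v)
  run-++ []           v st       = refl
  run-++ (push i ∷ u) v st       = run-++ u v (i ∷ st)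
  run-++ (pop i ∷ u) v []       = refl
  run-++ (pop i ∷ u) v (j ∷ st) with i ≟ j
  ... | yes _ = run-++ u v st
  ... | no  _ = refl

  run-close-match : ∀ i w st → run (pop i ∷ w) (i ∷ st) ≡ run w st
  run-close-match i w st with i ≟ i
  ... | yes _  = refl
  ... | no i≢i = contradiction refl i≢i

  run-close-mismatch : ∀ {i j} w st → i ≢ j → run (pop i ∷ w) (j ∷ st) ≡ nothing
  run-close-mismatch {i} {j} w st i≢j with i ≟ j
  ... | yes i≡j = contradiction i≡j i≢j
  ... | no  _   = refl

  run-close⁻ : ∀ i w st {st′} → run (pop i ∷ w) st ≡ just st′ →
               ∃ λ st₀ → st ≡ i ∷ st₀ × run w st₀ ≡ just st′
  run-close⁻ i w (j ∷ st) eq with i ≟ j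
  run-close⁻ i w (.i ∷ st) eq | yes refl = st , refl , eq

module DyckRecognition {n : ℕ} where
  open StackMachine (_≟Fin_ {n})

  Dyck⇒run : ∀ {w} → Dyck w → ∀ st → run w st ≡ just st
  Dyck⇒run ε st = refl
  Dyck⇒run (nest i {w} d) st
    rewrite run-++ w (pop i ∷ []) (i ∷ st) | Dyck⇒run d (i ∷ st) = run-close-match i [] st
  Dyck⇒run (cat {u} {v} du dv) st rewrite run-++ u v st | Dyck⇒run du st = Dyck⇒run dv st

  -- Closes st w: w = d₁ )ᵢ₁ d₂ )ᵢ₂ … dₖ )ᵢₖ d with st = i₁ … iₖ and every dⱼ, d balanced.
  data Closes : List (Fin n) → List (Ω n) → Set where
    done  : ∀ {w} → Dyck w → Closes [] w
    close : ∀ {i st d w} → Dyck d → Closes st w → Closes (i ∷ st) (d ++ pop i ∷ w)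

  Closes-prepend : ∀ {e st w} → Dyck e → Closes st w → Closes st (e ++ w)
  Closes-prepend de (done dw) = done (cat de dw)
  Closes-prepend {e} de (close {i} {_} {d} {w} dd c) =
    subst (Closes _) (++-assoc e d (pop i ∷ w)) (close (cat de dd) c)

  run⇒Closes : ∀ w st → run w st ≡ just [] → Closes st w
  run⇒Closes [] [] refl = done ε
  run⇒Closes (push i ∷ w) st eq with run⇒Closes w (i ∷ st) eq
  ... | close {d = d} {w = w′} dd c =
    subst (Closes st) (++-assoc (push i ∷ d) (pop i ∷ []) w′) (Closes-prepend (nest i dd) c)
  run⇒Closes (pop i ∷ w) st eq with run-close⁻ i w st eq
  ... | st₀ , refl , eq₀ = close {d = []} ε (run⇒Closes w st₀ eq₀)

  run⇒Dyck : ∀ {w} → run w [] ≡ just [] → Dyck w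
  run⇒Dyck {w} eq with run⇒Closes w [] eq
  ... | done d = d

  ¬Dyck-close : ∀ {i} → ¬ Dyck (pop i ∷ [])
  ¬Dyck-close d with Dyck⇒run d []
  ... | ()

-- Coding many bracket types by two

module BlockCode {n : ℕ} (one two : Fin n) (one≢two : one ≢ two) where
  open StackMachine (_≟Fin_ {n})

  openBlock : ℕ → List (Ω n)
  openBlock k = push one ∷ replicate k (push two)

  closeBlock : ℕ → List (Ω n)
  closeBlock k = replicate k (pop two) ++ pop one ∷ []

  pushBlock : ℕ → List (Fin n) → List (Fin n)
  pushBlock k st = replicate k two ++ one ∷ st

  replicate-∷ : ∀ {X : Set} k (x : X) st → replicate k x ++ x ∷ st ≡ x ∷ replicate k x ++ st
  replicate-∷ zero    x st = refl
  replicate-∷ (suc k) x st = cong (x ∷_) (replicate-∷ k x st)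

  run-openBlock : ∀ k st → run (openBlock k) st ≡ just (pushBlock k st)
  run-openBlock k st = go k (one ∷ st)
    where
    go : ∀ k st → run (replicate k (push two)) st ≡ just (replicate k two ++ st)
    go zero    st = refl
    go (suc k) st = trans (go k (two ∷ st)) (cong just (replicate-∷ k two st))

  run-closeBlock : ∀ k st → run (closeBlock k) (pushBlock k st) ≡ just st
  run-closeBlock zero    st = run-close-match one [] st
  run-closeBlock (suc k) st = trans (run-close-match two _ _) (run-closeBlock k st)

  run-closeBlock-≢ : ∀ k k′ st → k ≢ k′ → run (closeBlock k) (pushBlock k′ st) ≡ nothing
  run-closeBlock-≢ zero    zero     st k≢k′ = contradiction refl k≢k′
  run-closeBlock-≢ zero    (suc k′) st _    = run-close-mismatch _ _ one≢two
  run-closeBlock-≢ (suc k) zero     st _    = run-close-mismatch _ _ (λ e → one≢two (sym e))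
  run-closeBlock-≢ (suc k) (suc k′) st k≢k′ =
    trans (run-close-match two _ _) (run-closeBlock-≢ k k′ st (λ e → k≢k′ (cong suc e)))

  run-closeBlock-[] : ∀ k → run (closeBlock k) [] ≡ nothing
  run-closeBlock-[] zero    = refl
  run-closeBlock-[] (suc k) = refl

  openCode : List ℕ → List (Ω n)
  openCode = concatMap openBlock

  closeCode : List ℕ → List (Ω n)
  closeCode = foldr (λ k w → w ++ closeBlock k) []

  pushCode : List ℕ → List (Fin n) → List (Fin n)
  pushCode []       st = st
  pushCode (k ∷ ks) st = pushCode ks (pushBlock k st)

  run-openCode : ∀ ks st → run (openCode ks) st ≡ just (pushCode ks st)
  run-openCode []       st = refl
  run-openCode (k ∷ ks) st
    rewrite run-++ (openBlock k) (openCode ks) st | run-openBlock k st = run-openCode ks (pushBlock k st)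

  run-closeCode : ∀ ks st → run (closeCode ks) (pushCode ks st) ≡ just st
  run-closeCode []       st = refl
  run-closeCode (k ∷ ks) st
    rewrite run-++ (closeCode ks) (closeBlock k) (pushCode ks (pushBlock k st))
          | run-closeCode ks (pushBlock k st) = run-closeBlock k st

  -- Equal lengths make the block codes prefix-free.
  run-closeCode-≢ : ∀ ks ks′ st → length ks ≡ length ks′ → ks ≢ ks′ →
                    run (closeCode ks) (pushCode ks′ st) ≡ nothing
  run-closeCode-≢ []       []         st _   ks≢ks′ = contradiction refl ks≢ks′
  run-closeCode-≢ (k ∷ ks) (k′ ∷ ks′) st len ks≢ks′
    rewrite run-++ (closeCode ks) (closeBlock k) (pushCode ks′ (pushBlock k′ st))
    with ≡-dec _≟ℕ_ ks ks′
  ... | yes refl rewrite run-closeCode ks (pushBlock k′ st) =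
    run-closeBlock-≢ k k′ st (λ e → ks≢ks′ (cong (_∷ ks) e))
  ... | no ne rewrite run-closeCode-≢ ks ks′ (pushBlock k′ st) (suc-injective len) ne = refl

  run-closeCode-[] : ∀ ks → ks ≢ [] → run (closeCode ks) [] ≡ nothing
  run-closeCode-[] []             ks≢[] = contradiction refl ks≢[]
  run-closeCode-[] (k ∷ [])       _     = run-closeBlock-[] k
  run-closeCode-[] (k ∷ k′ ∷ ks) _     =
    trans (run-++ (closeCode (k′ ∷ ks)) (closeBlock k) [])
          (cong (_>>= run (closeBlock k)) (run-closeCode-[] (k′ ∷ ks) (λ ())))

  pushCode-nonempty : ∀ ks st → ks ≢ [] → pushCode ks st ≢ []
  pushCode-nonempty []            st ks≢[] = contradiction refl ks≢[]
  pushCode-nonempty (zero ∷ [])   st _     = λ ()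
  pushCode-nonempty (suc k ∷ [])  st _     = λ ()
  pushCode-nonempty (k ∷ k′ ∷ ks) st _     = pushCode-nonempty (k′ ∷ ks) (pushBlock k st) (λ ())

module BracketEncoding {n : ℕ} (one two : Fin n) (one≢two : one ≢ two)
  {Γ : Set} (_≟Γ_ : DecidableEquality Γ) (code : Γ → List ℕ)
  (code-length : ∀ g g′ → length (code g) ≡ length (code g′))
  (code-injective : ∀ {g g′} → code g ≡ code g′ → g ≡ g′)
  (code-nonempty : ∀ g → code g ≢ [])
  where
  open BlockCode one two one≢two
  open StackMachine (_≟Fin_ {n})
  open StackMachine _≟Γ_ using () renaming (run to runΓ)
  open DyckRecognition {n}

  encodeBracket : Γ ⊎ Γ → List (Ω n)
  encodeBracket (push g) = openCode (code g)
  encodeBracket (pop g) = closeCode (code g)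

  encode : List (Γ ⊎ Γ) → List (Ω n)
  encode = concatMap encodeBracket

  encodeStack : List Γ → List (Fin n)
  encodeStack = foldr (λ g → pushCode (code g)) []

  run-encode : ∀ bs γ → run (encode bs) (encodeStack γ) ≡ Maybe.map encodeStack (runΓ bs γ)
  run-encode [] γ = refl
  run-encode (push g ∷ bs) γ
    rewrite run-++ (openCode (code g)) (encode bs) (encodeStack γ)
          | run-openCode (code g) (encodeStack γ) = run-encode bs (g ∷ γ)
  run-encode (pop g ∷ bs) []
    rewrite run-++ (closeCode (code g)) (encode bs) []
          | run-closeCode-[] (code g) (code-nonempty g) = refl
  run-encode (pop g ∷ bs) (g′ ∷ γ)
    rewrite run-++ (closeCode (code g)) (encode bs) (encodeStack (g′ ∷ γ)) with g ≟Γ g′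
  ... | yes refl rewrite run-closeCode (code g) (encodeStack γ) = run-encode bs γ
  ... | no g≢g′
    rewrite run-closeCode-≢ (code g) (code g′) (encodeStack γ) (code-length g g′)
                            (λ e → g≢g′ (code-injective e))
    = refl

  encodeStack-[] : ∀ γ → encodeStack γ ≡ [] → γ ≡ []
  encodeStack-[] []      _  = refl
  encodeStack-[] (g ∷ γ) eq = contradiction eq (pushCode-nonempty (code g) _ (code-nonempty g))

  Dyck-encode⇔ : ∀ bs → Dyck (encode bs) ⇔ runΓ bs [] ≡ just []
  Dyck-encode⇔ bs = mk⇔ to (λ eq → run⇒Dyck (trans (run-encode bs []) (cong (Maybe.map encodeStack) eq)))
    where
    to : Dyck (encode bs) → runΓ bs [] ≡ just []
    to d with runΓ bs [] | trans (sym (Dyck⇒run d [])) (run-encode bs [])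
    ... | just γ | eq = cong just (encodeStack-[] γ (sym (just-injective eq)))

-- Transducers and weighted automata

record Transducer (A X : Set) (k : ℕ) : Set where
  field
    emit  : Fin k → A → Fin k → List (List X)
    final : Fin k → List (List X)

module _ {A X : Set} {k : ℕ} (T : Transducer A X k) where
  open Transducer T

  data Translates : Fin k → List A → List X → Set where
    stop : ∀ {x u} → u ∈ final x → Translates x [] u
    step : ∀ {x a y c w u} → c ∈ emit x a y → Translates y w u → Translates x (a ∷ w) (c ++ u)

mapOutput : ∀ {A X Y k} → (List X → List Y) → Transducer A X k → Transducer A Y k
mapOutput f T = record { emit = λ x a y → map f (emit x a y) ; final = λ x → map f (final x) }
  where open Transducer T

module _ {A X Y : Set} {k : ℕ} (T : Transducer A X k) (f : List X → List Y)
         (f-++ : ∀ u v → f (u ++ v) ≡ f u ++ f v) where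

  Translates-map⁺ : ∀ {x w u} → Translates T x w u → Translates (mapOutput f T) x w (f u)
  Translates-map⁺ (stop u∈) = stop (∈-map⁺ f u∈)
  Translates-map⁺ (step {c = c} {u = u} c∈ t) =
    subst (Translates _ _ _) (sym (f-++ c u)) (step (∈-map⁺ f c∈) (Translates-map⁺ t))

  Translates-map⁻ : ∀ {x w v} → Translates (mapOutput f T) x w v →
                    ∃ λ u → v ≡ f u × Translates T x w u
  Translates-map⁻ (stop v∈) with ∈-map⁻ f v∈
  ... | u , u∈ , refl = u , refl , stop u∈
  Translates-map⁻ (step c∈ t) with ∈-map⁻ f c∈ | Translates-map⁻ t
  ... | c , c∈′ , refl | u , refl , t′ = c ++ u , sym (f-++ c u) , step c∈′ t′

module SemimoduleOrder {c ℓ m ℓm : Level} {R : Semiring c ℓ} (B : LeftSemimodule R m ℓm) where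
  open LeftSemimodule B
  open SetoidReasoning ≈ᴹ-setoid

  private
    _≤ᴹ_ = _≤ᴮ_ B

  ≤-respʳ-≈ : ∀ {b d d′} → b ≤ᴹ d → d ≈ᴹ d′ → b ≤ᴹ d′
  ≤-respʳ-≈ {b} {d} {d′} b≤d d≈d′ = begin
    b +ᴹ d′ ≈⟨ +ᴹ-congˡ (≈ᴹ-sym d≈d′) ⟩
    b +ᴹ d  ≈⟨ b≤d ⟩
    d       ≈⟨ d≈d′ ⟩
    d′      ∎

  ≤-+ˡ : ∀ {b d e} → b ≤ᴹ d → b ≤ᴹ (d +ᴹ e)
  ≤-+ˡ {b} {d} {e} b≤d = begin
    b +ᴹ (d +ᴹ e) ≈⟨ ≈ᴹ-sym (+ᴹ-assoc b d e) ⟩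
    (b +ᴹ d) +ᴹ e ≈⟨ +ᴹ-congʳ b≤d ⟩
    d +ᴹ e        ∎

  ≤-+ʳ : ∀ {b d e} → b ≤ᴹ e → b ≤ᴹ (d +ᴹ e)
  ≤-+ʳ {b} {d} {e} b≤e = ≤-respʳ-≈ (≤-+ˡ b≤e) (+ᴹ-comm e d)

  ≤0⇒≤ : ∀ {b d} → b ≤ᴹ 0ᴹ → b ≤ᴹ d
  ≤0⇒≤ {b} {d} b≤0 = begin
    b +ᴹ d          ≈⟨ +ᴹ-congˡ (≈ᴹ-sym (+ᴹ-identityˡ d)) ⟩
    b +ᴹ (0ᴹ +ᴹ d)  ≈⟨ ≈ᴹ-sym (+ᴹ-assoc b 0ᴹ d) ⟩
    (b +ᴹ 0ᴹ) +ᴹ d  ≈⟨ +ᴹ-congʳ b≤0 ⟩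
    0ᴹ +ᴹ d         ≈⟨ +ᴹ-identityˡ d ⟩
    d               ∎

  module _ {b : Carrierᴹ} (b≰0 : ¬ b ≤ᴹ 0ᴹ) (prime : PrimeElement B b) where

    prime-Σᴹ : ∀ {k} (f : Fin k → Carrierᴹ) → b ≤ᴹ Σᴹ B f → ∃ λ i → b ≤ᴹ f i
    prime-Σᴹ {zero}  f b≤0 = contradiction b≤0 b≰0
    prime-Σᴹ {suc k} f b≤Σ with prime _ _ b≤Σ
    ... | inj₁ b≤f₀ = zero , b≤f₀
    ... | inj₂ b≤Σ′ with prime-Σᴹ (λ i → f (suc i)) b≤Σ′
    ...   | i , b≤fᵢ = suc i , b≤fᵢ

  ≤-Σᴹ : ∀ {b k} (f : Fin k → Carrierᴹ) i → b ≤ᴹ f i → b ≤ᴹ Σᴹ B f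
  ≤-Σᴹ {k = suc k} f zero    b≤f₀ = ≤-+ˡ b≤f₀
  ≤-Σᴹ {k = suc k} f (suc i) b≤fᵢ = ≤-+ʳ (≤-Σᴹ (λ j → f (suc j)) i b≤fᵢ)

  *ₗ-Σᴹ : ∀ r {k} (f : Fin k → Carrierᴹ) → (r *ₗ Σᴹ B f) ≈ᴹ Σᴹ B (λ i → r *ₗ f i)
  *ₗ-Σᴹ r {zero}  f = *ₗ-zeroʳ r
  *ₗ-Σᴹ r {suc k} f = ≈ᴹ-trans (*ₗ-distribˡ r _ _) (+ᴹ-congˡ (*ₗ-Σᴹ r (λ i → f (suc i))))

module WeightedRecognition {c ℓ m ℓm : Level} {R : Semiring c ℓ} (B : LeftSemimodule R m ℓm)
  {X : Set} (φ : MonoidMorphism R X) (D : List X → Set) (b₀ b₁ : LeftSemimodule.Carrierᴹ B)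
  (characterisation : ∀ w → _≤ᴮ_ B b₁ (LeftSemimodule._*ₗ_ B (MonoidMorphism.α φ w) b₀) ⇔ D w)
  (b₁≰0 : ¬ _≤ᴮ_ B b₁ (LeftSemimodule.0ᴹ B)) (prime : PrimeElement B b₁)
  where
  open Semiring R using (Carrier; _+_; 0#) renaming (sym to symR)
  open LeftSemimodule B
  open MonoidMorphism φ
  open SemimoduleOrder B

  private
    _≤ᴹ_ = _≤ᴮ_ B

  weight : List (List X) → Carrier
  weight = foldr (λ c r → α c + r) 0#

  automaton : ∀ {A k} → Transducer A X k → Automaton B A k
  automaton T = record
    { out   = λ x → weight (final x) *ₗ b₀
    ; trans = λ a x y → weight (emit x a y) }
    where open Transducer T

  α-*ₗ : ∀ p q t → (α p *ₗ (α q *ₗ t)) ≈ᴹ (α (p ++ q) *ₗ t)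
  α-*ₗ p q t = ≈ᴹ-trans (≈ᴹ-sym (*ₗ-assoc (α p) (α q) t)) (*ₗ-congʳ (symR (α-++ p q)))

  α[]-*ₗ : ∀ t → (α [] *ₗ t) ≈ᴹ t
  α[]-*ₗ t = ≈ᴹ-trans (*ₗ-congʳ α-ε) (*ₗ-identityˡ t)

  weight-∷-*ₗ : ∀ p c cs t →
    (α p *ₗ (weight (c ∷ cs) *ₗ t)) ≈ᴹ ((α (p ++ c) *ₗ t) +ᴹ (α p *ₗ (weight cs *ₗ t)))
  weight-∷-*ₗ p c cs t =
    ≈ᴹ-trans (*ₗ-congˡ (*ₗ-distribʳ t (α c) (weight cs)))
             (≈ᴹ-trans (*ₗ-distribˡ (α p) _ _) (+ᴹ-congʳ (α-*ₗ p c t)))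

  ≤-weight⁻ : ∀ cs p t → b₁ ≤ᴹ (α p *ₗ (weight cs *ₗ t)) →
              ∃ λ c → c ∈ cs × b₁ ≤ᴹ (α (p ++ c) *ₗ t)
  ≤-weight⁻ []       p t b₁≤ =
    contradiction (≤-respʳ-≈ b₁≤ (≈ᴹ-trans (*ₗ-congˡ (*ₗ-zeroˡ t)) (*ₗ-zeroʳ (α p)))) b₁≰0
  ≤-weight⁻ (c ∷ cs) p t b₁≤ with prime _ _ (≤-respʳ-≈ b₁≤ (weight-∷-*ₗ p c cs t))
  ... | inj₁ b₁≤c = c , here refl , b₁≤c
  ... | inj₂ b₁≤cs with ≤-weight⁻ cs p t b₁≤cs
  ...   | c′ , c′∈ , b₁≤c′ = c′ , there c′∈ , b₁≤c′

  ≤-weight⁺ : ∀ cs p t {c} → c ∈ cs → b₁ ≤ᴹ (α (p ++ c) *ₗ t) →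
              b₁ ≤ᴹ (α p *ₗ (weight cs *ₗ t))
  ≤-weight⁺ (c ∷ cs) p t (here refl) b₁≤ =
    ≤-respʳ-≈ (≤-+ˡ b₁≤) (≈ᴹ-sym (weight-∷-*ₗ p c cs t))
  ≤-weight⁺ (c′ ∷ cs) p t (there c∈) b₁≤ =
    ≤-respʳ-≈ (≤-+ʳ (≤-weight⁺ cs p t c∈ b₁≤)) (≈ᴹ-sym (weight-∷-*ₗ p c′ cs t))

  module _ {A : Set} {k : ℕ} (T : Transducer A X k) where
    open Transducer T

    private
      M = automaton T

      successors : Fin k → A → List A → Fin k → Carrierᴹ
      successors x a w y = weight (emit x a y) *ₗ trace B M y w

    -- The prefix p already emitted is carried along as the scalar α p.
    ≤-trace⁻ : ∀ x w p → b₁ ≤ᴹ (α p *ₗ trace B M x w) →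
               ∃ λ u → Translates T x w u × D (p ++ u)
    ≤-trace⁻ x [] p b₁≤ with ≤-weight⁻ (final x) p b₀ b₁≤
    ... | u , u∈ , b₁≤u = u , stop u∈ , Equivalence.to (characterisation _) b₁≤u
    ≤-trace⁻ x (a ∷ w) p b₁≤
      with prime-Σᴹ b₁≰0 prime _ (≤-respʳ-≈ b₁≤ (*ₗ-Σᴹ (α p) (successors x a w)))
    ... | y , b₁≤y with ≤-weight⁻ (emit x a y) p _ b₁≤y
    ...   | c , c∈ , b₁≤c with ≤-trace⁻ y w (p ++ c) b₁≤c
    ...     | u , t , d = c ++ u , step c∈ t , subst D (++-assoc p c u) d

    ≤-trace⁺ : ∀ {x w u} p → Translates T x w u → D (p ++ u) → b₁ ≤ᴹ (α p *ₗ trace B M x w)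
    ≤-trace⁺ {x} p (stop u∈) d = ≤-weight⁺ (final x) p b₀ u∈ (Equivalence.from (characterisation _) d)
    ≤-trace⁺ {x} p (step {a = a} {y = y} {c = c} {w = w} {u = u} c∈ t) d =
      ≤-respʳ-≈ (≤-Σᴹ (λ y → α p *ₗ successors x a w y) y b₁≤y) (≈ᴹ-sym (*ₗ-Σᴹ (α p) (successors x a w)))
      where
      b₁≤y : b₁ ≤ᴹ (α p *ₗ successors x a w y)
      b₁≤y = ≤-weight⁺ (emit x a y) p _ c∈ (≤-trace⁺ (p ++ c) t (subst D (sym (++-assoc p c u)) d))

    recognises : ∀ x w → b₁ ≤ᴹ trace B M x w ⇔ ∃ λ u → Translates T x w u × D u
    recognises x w = mk⇔
      (λ b₁≤ → ≤-trace⁻ x w [] (≤-respʳ-≈ b₁≤ (≈ᴹ-sym (α[]-*ₗ _))))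
      (λ { (u , t , d) → ≤-respʳ-≈ (≤-trace⁺ [] t d) (α[]-*ₗ _) })

-- Chomsky–Schützenberger for binary grammars

-- Chomsky normal form without ε-rules
module BinaryGrammar {A Sym : Set} (leaves : List (Sym × A)) (branches : List (Sym × Sym × Sym)) where

  data Yields : Sym → List A → Set where
    leaf   : ∀ {s a} → (s , a) ∈ leaves → Yields s (a ∷ [])
    branch : ∀ {s l r u v} → (s , l , r) ∈ branches → Yields l u → Yields r v → Yields s (u ++ v)

-- A pending s asks for a subtree of s; a held s is a finished left subtree of s awaiting its sibling.
data Slot (Sym : Set) : Set where
  pending held : Sym → Slot Sym

data Side : Set where
  left right : Side

sides : List Side
sides = left ∷ right ∷ []

∈-sides : ∀ σ → σ ∈ sides
∈-sides left  = here refl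
∈-sides right = there (here refl)

pattern initial = zero
pattern inner   = suc zero
pattern last    = suc (suc zero)

module ChomskySchützenberger {A Sym : Set} (_≟A_ : DecidableEquality A) (_≟S_ : DecidableEquality Sym)
  (leaves : List (Sym × A)) (branches : List (Sym × Sym × Sym)) (start : Sym)
  {E : Set} (E? : Dec E)
  where
  open BinaryGrammar leaves branches

  _≟Slot_ : DecidableEquality (Slot Sym)
  pending s ≟Slot pending s′ with s ≟S s′
  ... | yes refl = yes refl
  ... | no  s≢s′ = no λ { refl → s≢s′ refl }
  pending s ≟Slot held s′ = no λ ()
  held s ≟Slot pending s′ = no λ ()
  held s ≟Slot held s′ with s ≟S s′
  ... | yes refl = yes refl
  ... | no  s≢s′ = no λ { refl → s≢s′ refl }

  open StackMachine _≟Slot_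

  Brackets : Set
  Brackets = List (Slot Sym ⊎ Slot Sym)

  leafBrackets : Sym → Side → Brackets
  leafBrackets s left  = push (held s) ∷ []
  leafBrackets s right = pop (pending s) ∷ []

  gapBrackets : Sym × Sym × Sym → Side → Brackets
  gapBrackets (t , l , r) left  = pop (held l) ∷ push (held t) ∷ push (pending r) ∷ []
  gapBrackets (t , l , r) right = pop (held l) ∷ pop (pending t) ∷ push (pending r) ∷ []

  leavesOf : A → List (Sym × A)
  leavesOf a = filter (λ p → proj₂ p ≟A a) leaves

  leafOptions : A → List Brackets
  leafOptions a = cartesianProductWith (λ p → leafBrackets (proj₁ p)) (leavesOf a) sides

  gapOptions : List Brackets
  gapOptions = cartesianProductWith gapBrackets branches sides

  leafGapOptions : A → List Brackets
  leafGapOptions a = cartesianProductWith _++_ (leafOptions a) gapOptions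

  leafOptions⁻ : ∀ {a c} → c ∈ leafOptions a →
                 ∃₂ λ s σ → (s , a) ∈ leaves × c ≡ leafBrackets s σ
  leafOptions⁻ {a} c∈ with ∈-cartesianProductWith⁻ _ (leavesOf a) sides c∈
  ... | (s , _) , σ , p∈ , _ , refl with ∈-filter⁻ (λ p → proj₂ p ≟A a) p∈
  ...   | s∈ , refl = s , σ , s∈ , refl

  leafOptions⁺ : ∀ {a s} σ → (s , a) ∈ leaves → leafBrackets s σ ∈ leafOptions a
  leafOptions⁺ {a} σ s∈ =
    ∈-cartesianProductWith⁺ (λ p → leafBrackets (proj₁ p))
                            (∈-filter⁺ (λ p → proj₂ p ≟A a) s∈ refl) (∈-sides σ)

  leafGapOptions⁻ : ∀ {a c} → c ∈ leafGapOptions a →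
    ∃₂ λ s σ → ∃₂ λ g τ →
      (s , a) ∈ leaves × g ∈ branches × c ≡ leafBrackets s σ ++ gapBrackets g τ
  leafGapOptions⁻ {a} c∈ with ∈-cartesianProductWith⁻ _++_ (leafOptions a) gapOptions c∈
  ... | _ , _ , l∈ , g∈ , refl
    with leafOptions⁻ l∈ | ∈-cartesianProductWith⁻ gapBrackets branches sides g∈
  ...   | s , σ , s∈ , refl | g , τ , g∈′ , _ , refl = s , σ , g , τ , s∈ , g∈′ , refl

  leafGapOptions⁺ : ∀ {a s g} σ τ → (s , a) ∈ leaves → g ∈ branches →
    leafBrackets s σ ++ gapBrackets g τ ∈ leafGapOptions a
  leafGapOptions⁺ σ τ s∈ g∈ =
    ∈-cartesianProductWith⁺ _++_ (leafOptions⁺ σ s∈)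
                            (∈-cartesianProductWith⁺ gapBrackets g∈ (∈-sides τ))

  emptyOutput : Dec E → List Brackets
  emptyOutput (yes _) = [] ∷ []
  emptyOutput (no  _) = []

  emptyOutput⁻ : ∀ {u} d → u ∈ emptyOutput d → E
  emptyOutput⁻ (yes e) _ = e

  emptyOutput⁺ : ∀ d → E → [] ∈ emptyOutput d
  emptyOutput⁺ (yes _) _ = here refl
  emptyOutput⁺ (no ¬e) e = contradiction e ¬e

  emitFrom : A → Fin 3 → List Brackets
  emitFrom a inner = leafGapOptions a
  emitFrom a last  = leafOptions a
  emitFrom a _     = []

  emit : Fin 3 → A → Fin 3 → List Brackets
  emit initial a y = map (push (pending start) ∷_) (emitFrom a y)
  emit inner   a y = emitFrom a y
  emit _       _ _ = []

  final : Fin 3 → List Brackets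
  final initial = emptyOutput E?
  final last    = [] ∷ []
  final _       = []

  transducer : Transducer A (Slot Sym ⊎ Slot Sym) 3
  transducer = record { emit = emit ; final = final }

  Inner : List A → Brackets → Set
  Inner = Translates transducer inner

  -- Completes γ w: the subtrees spelled by w fill the pending slots of γ, consuming its held subtrees.
  mutual
    data Completes : List (Slot Sym) → List A → Set where
      only : ∀ {s w} → Yields s w → Completes (pending s ∷ []) w
      then : ∀ {s x γ u v} → Yields s u → CompletesAfter x γ v →
             Completes (pending s ∷ held x ∷ γ) (u ++ v)

    data CompletesAfter : Sym → List (Slot Sym) → List A → Set where
      fill : ∀ {t x r γ v} → (t , x , r) ∈ branches → Completes (pending r ∷ γ) v →
             CompletesAfter x (pending t ∷ γ) v
      hold : ∀ {t x r γ v} → (t , x , r) ∈ branches → Completes (pending r ∷ held t ∷ γ) v →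
             CompletesAfter x γ v

  Yields-CompletesAfter : ∀ {x u γ v} → Yields x u → CompletesAfter x γ v → Completes γ (u ++ v)
  Yields-CompletesAfter y (fill b∈ (only y′)) = only (branch b∈ y y′)
  Yields-CompletesAfter {u = u} y (fill b∈ (then {u = u′} {v = v} y′ c)) =
    subst (Completes _) (++-assoc u u′ v) (then (branch b∈ y y′) c)
  Yields-CompletesAfter {u = u} y (hold b∈ (then {u = u′} {v = v} y′ c)) =
    subst (Completes _) (++-assoc u u′ v) (Yields-CompletesAfter (branch b∈ y y′) c)

  gap-sound : ∀ {t l r} τ {bs γ w} → (t , l , r) ∈ branches →
    run (gapBrackets (t , l , r) τ ++ bs) γ ≡ just [] →
    (∀ δ → run bs δ ≡ just [] → Completes δ w) →
    ∃ λ γ′ → γ ≡ held l ∷ γ′ × CompletesAfter l γ′ w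
  gap-sound {l = l} left {γ = γ} b∈ eq complete with run-close⁻ (held l) _ γ eq
  ... | γ′ , refl , eq′ = γ′ , refl , hold b∈ (complete _ eq′)
  gap-sound {t} {l} right {γ = γ} b∈ eq complete with run-close⁻ (held l) _ γ eq
  ... | γ′ , refl , eq′ with run-close⁻ (pending t) _ γ′ eq′
  ...   | γ″ , refl , eq″ = _ , refl , fill b∈ (complete _ eq″)

  Inner-sound : ∀ {w bs} → Inner w bs → ∀ γ → run bs γ ≡ just [] → Completes γ w
  Inner-sound (step {y = initial} () _)
  Inner-sound (step {y = suc (suc (suc ()))} _ _)
  Inner-sound (step {y = last} _ (step () _))
  Inner-sound (step {y = last} c∈ (stop (here refl))) γ eq with leafOptions⁻ c∈
  ... | s , right , s∈ , refl with run-close⁻ (pending s) [] γ eq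
  ...   | _ , refl , refl = only (leaf s∈)
  Inner-sound (step {y = inner} {u = bs} c∈ t) γ eq with leafGapOptions⁻ c∈
  ... | s , σ , g , τ , s∈ , b∈ , refl
    with subst (λ bs′ → run bs′ γ ≡ just []) (++-assoc (leafBrackets s σ) (gapBrackets g τ) bs) eq
  Inner-sound (step {y = inner} c∈ t) γ eq | s , left , g , τ , s∈ , b∈ , refl | eq′
    with gap-sound τ b∈ eq′ (Inner-sound t)
  ... | _ , refl , c = Yields-CompletesAfter (leaf s∈) c
  Inner-sound (step {y = inner} c∈ t) γ eq | s , right , g , τ , s∈ , b∈ , refl | eq′
    with run-close⁻ (pending s) _ γ eq′
  ... | δ , refl , eq″ with gap-sound τ b∈ eq″ (Inner-sound t)
  ...   | _ , refl , c = then (leaf s∈) c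

  Gap : Set
  Gap = (Sym × Sym × Sym) × Side

  gapOf : Maybe Gap → Brackets
  gapOf nothing        = []
  gapOf (just (g , τ)) = gapBrackets g τ

  data Continuation : Maybe Gap → List A → Brackets → Set where
    end : Continuation nothing [] []
    gap : ∀ {g τ w bs} → g ∈ branches → Inner w bs → Continuation (just (g , τ)) w bs

  -- the stack before and after the subtree of s, read as a σ-child
  before after : Side → Sym → List (Slot Sym) → List (Slot Sym)
  before left  s γ = γ
  before right s γ = pending s ∷ γ
  after  left  s γ = held s ∷ γ
  after  right s γ = γ

  run-leaf : ∀ s σ bs γ → run (leafBrackets s σ ++ bs) (before σ s γ) ≡ run bs (after σ s γ)
  run-leaf s left  bs γ = refl
  run-leaf s right bs γ = run-close-match (pending s) bs γ

  Yields-complete : ∀ {s u} → Yields s u → ∀ σ {G w bs′} → Continuation G w bs′ →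
    ∃ λ bs → Inner (u ++ w) bs × (∀ γ → run bs (before σ s γ) ≡ run (gapOf G ++ bs′) (after σ s γ))
  Yields-complete (leaf {s} s∈) σ end =
    leafBrackets s σ ++ [] , step {y = last} (leafOptions⁺ σ s∈) (stop (here refl)) , run-leaf s σ []
  Yields-complete (leaf {s} s∈) σ (gap {g} {τ} {bs = bs′} b∈ t) =
    (leafBrackets s σ ++ gapBrackets g τ) ++ bs′ , step {y = inner} (leafGapOptions⁺ σ τ s∈ b∈) t ,
    λ γ → trans (cong (λ bs → run bs (before σ s γ)) (++-assoc (leafBrackets s σ) (gapBrackets g τ) bs′))
                (run-leaf s σ (gapBrackets g τ ++ bs′) γ)
  Yields-complete (branch {s} {l} {r} {u₁} {u₂} b∈ y₁ y₂) σ {G} {w} {bs′} k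
    with Yields-complete y₂ right k
  ... | bs₂ , t₂ , run₂ with Yields-complete y₁ left {just ((s , l , r) , σ)} (gap b∈ t₂)
  ...   | bs₁ , t₁ , run₁ =
    bs₁ , subst (λ v → Inner v bs₁) (sym (++-assoc u₁ u₂ w)) t₁ , run-branch σ run₁
    where
    run-branch : ∀ σ → (∀ γ → run bs₁ γ ≡ run (gapBrackets (s , l , r) σ ++ bs₂) (held l ∷ γ)) →
                 ∀ γ → run bs₁ (before σ s γ) ≡ run (gapOf G ++ bs′) (after σ s γ)
    run-branch left  run₁ γ = trans (run₁ γ) (trans (run-close-match (held l) _ _) (run₂ (held s ∷ γ)))
    run-branch right run₁ γ =
      trans (run₁ (pending s ∷ γ))
            (trans (run-close-match (held l) _ _) (trans (run-close-match (pending s) _ _) (run₂ γ)))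

  Accepts : List A → Brackets → Set
  Accepts = Translates transducer initial

  Accepts-sound : ∀ {w bs} → Accepts w bs → run bs [] ≡ just [] → (w ≡ [] × E) ⊎ Yields start w
  Accepts-sound (stop u∈) _ = inj₁ (refl , emptyOutput⁻ E? u∈)
  Accepts-sound (step {y = y} c∈ t) eq with ∈-map⁻ (push (pending start) ∷_) c∈
  ... | c , c∈′ , refl with Inner-sound (step {y = y} c∈′ t) (pending start ∷ []) eq
  ...   | only y′ = inj₂ y′

  Inner⇒Accepts : ∀ {w bs} → Inner w bs → Accepts w (push (pending start) ∷ bs)
  Inner⇒Accepts (stop ())
  Inner⇒Accepts (step c∈ t) = step (∈-map⁺ (push (pending start) ∷_) c∈) t

  Accepts-complete : ∀ {w} → (w ≡ [] × E) ⊎ Yields start w →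
                     ∃ λ bs → Accepts w bs × run bs [] ≡ just []
  Accepts-complete (inj₁ (refl , e)) = [] , stop (emptyOutput⁺ E? e) , refl
  Accepts-complete {w} (inj₂ y) with Yields-complete y right end
  ... | bs , t , run≡ =
    push (pending start) ∷ bs , Inner⇒Accepts (subst (λ v → Inner v bs) (++-identityʳ w) t) , run≡ []

  module Encoded {n : ℕ} (one two : Fin n) (one≢two : one ≢ two) (code : Sym → List ℕ)
           (code-length : ∀ s s′ → length (code s) ≡ length (code s′))
           (code-injective : ∀ {s s′} → code s ≡ code s′ → s ≡ s′) where

    slotCode : Slot Sym → List ℕ
    slotCode (pending s) = 0 ∷ code s
    slotCode (held s)    = 1 ∷ code s

    slotCode-length : ∀ g g′ → length (slotCode g) ≡ length (slotCode g′)
    slotCode-length (pending s) (pending s′) = cong suc (code-length s s′)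
    slotCode-length (pending s) (held s′)    = cong suc (code-length s s′)
    slotCode-length (held s)    (pending s′) = cong suc (code-length s s′)
    slotCode-length (held s)    (held s′)    = cong suc (code-length s s′)

    slotCode-injective : ∀ {g g′} → slotCode g ≡ slotCode g′ → g ≡ g′
    slotCode-injective {pending _} {pending _} eq = cong pending (code-injective (proj₂ (∷-injective eq)))
    slotCode-injective {held _}    {held _}    eq = cong held (code-injective (proj₂ (∷-injective eq)))

    slotCode-nonempty : ∀ g → slotCode g ≢ []
    slotCode-nonempty (pending _) ()
    slotCode-nonempty (held _)    ()

    open BracketEncoding one two one≢two _≟Slot_ slotCode slotCode-length slotCode-injective slotCode-nonempty

    dyckTransducer : Transducer A (Ω n) 3
    dyckTransducer = mapOutput encode transducer

    Yields⇔translates-Dyck : ∀ w →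
      ((w ≡ [] × E) ⊎ Yields start w) ⇔ ∃ λ u → Translates dyckTransducer initial w u × Dyck u
    Yields⇔translates-Dyck w = mk⇔ to from
      where
      to : (w ≡ [] × E) ⊎ Yields start w → ∃ λ u → Translates dyckTransducer initial w u × Dyck u
      to yields with Accepts-complete yields
      ... | bs , t , run≡ =
        encode bs , Translates-map⁺ transducer encode (concatMap-++ encodeBracket) t ,
        Equivalence.from (Dyck-encode⇔ bs) run≡

      from : ∃ (λ u → Translates dyckTransducer initial w u × Dyck u) → (w ≡ [] × E) ⊎ Yields start w
      from (u , t , d) with Translates-map⁻ transducer encode (concatMap-++ encodeBracket) t
      ... | bs , refl , t′ = Accepts-sound t′ (Equivalence.to (Dyck-encode⇔ bs) d)

-- Horn saturation

-- A clause (x , ps) reads x ⇐ ps.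
module HornSaturation {F : Set} (_≟_ : DecidableEquality F)
  (atoms : List F) (∈-atoms : ∀ x → x ∈ atoms) (clauses : List (F × List F)) where
  open import Data.List.Membership.DecPropositional _≟_ using (_∈?_)

  data Derivable : F → Set where
    derive : ∀ {x ps} → (x , ps) ∈ clauses → All Derivable ps → Derivable x

  Fires : List F → F × List F → Set
  Fires S (x , ps) = x ∉ S × All (_∈ S) ps

  Closed : List F → Set
  Closed S = ∀ {x ps} → (x , ps) ∈ clauses → All (_∈ S) ps → x ∈ S

  fires-or-closed : ∀ S → ∃ (λ c → c ∈ clauses × Fires S c) ⊎ Closed S
  fires-or-closed S with any? (λ { (x , ps) → ¬? (x ∈? S) ×-dec all? (_∈? S) ps }) clauses
  ... | yes fires = inj₁ (find fires)
  ... | no ¬fires = inj₂ λ {x} c∈ ps⊆S →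
    decidable-stable (x ∈? S) (λ x∉S → ¬fires (lose c∈ (x∉S , ps⊆S)))

  unknowns : List F → List F → ℕ
  unknowns S []       = 0
  unknowns S (x ∷ xs) with x ∈? S
  ... | yes _ = unknowns S xs
  ... | no  _ = suc (unknowns S xs)

  unknowns-∷ : ∀ h S xs → unknowns (h ∷ S) xs ≤ unknowns S xs
  unknowns-∷ h S []       = z≤n
  unknowns-∷ h S (x ∷ xs) with x ∈? S | x ≟ h
  ... | yes _ | yes _ = unknowns-∷ h S xs
  ... | yes _ | no  _ = unknowns-∷ h S xs
  ... | no  _ | yes _ = m≤n⇒m≤1+n (unknowns-∷ h S xs)
  ... | no  _ | no  _ = s≤s (unknowns-∷ h S xs)

  unknowns-∷-< : ∀ {h} S xs → h ∈ xs → h ∉ S → unknowns (h ∷ S) xs < unknowns S xs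
  unknowns-∷-< {h} S (x ∷ xs) h∈ h∉S with x ∈? S | x ≟ h | h∈
  ... | yes x∈S | _        | here refl = contradiction x∈S h∉S
  ... | yes _   | yes _    | there h∈′ = unknowns-∷-< S xs h∈′ h∉S
  ... | yes _   | no  _    | there h∈′ = unknowns-∷-< S xs h∈′ h∉S
  ... | no  _   | yes _    | here refl = s≤s (unknowns-∷ h S xs)
  ... | no  _   | yes _    | there h∈′ = m≤n⇒m≤1+n (unknowns-∷-< S xs h∈′ h∉S)
  ... | no  _   | no  x≢h  | here refl = contradiction refl x≢h
  ... | no  _   | no  _    | there h∈′ = s≤s (unknowns-∷-< S xs h∈′ h∉S)

  saturate : ∀ S → All Derivable S → Acc _<_ (unknowns S atoms) →
             ∃ λ S′ → All Derivable S′ × Closed S′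
  saturate S derivS (acc rec) with fires-or-closed S
  ... | inj₂ closed = S , derivS , closed
  ... | inj₁ ((x , ps) , c∈ , x∉S , ps⊆S) =
    saturate (x ∷ S) (derive c∈ (All.map (All.lookup derivS) ps⊆S) ∷ derivS)
             (rec (unknowns-∷-< S atoms (∈-atoms x) x∉S))

  Closed-complete : ∀ {S} → Closed S → ∀ {x} → Derivable x → x ∈ S
  Closed-complete {S} closed (derive c∈ derivs) = closed c∈ (all∈ derivs)
    where
    all∈ : ∀ {ps} → All Derivable ps → All (_∈ S) ps
    all∈ []       = []
    all∈ (d ∷ ds) = Closed-complete closed d ∷ all∈ ds

  derivable? : ∀ x → Dec (Derivable x)
  derivable? x with saturate [] [] (<-wellFounded _)
  ... | S , derivS , closed =
    map′ (All.lookup derivS) (Closed-complete closed) (x ∈? S)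

-- Binarisation of context-free grammars

find-concatMap : ∀ {X Y : Set} (f : X → List Y) xs {y} → y ∈ concatMap f xs →
                 ∃ λ x → x ∈ xs × y ∈ f x
find-concatMap f xs y∈ = find (∈-concatMap⁻ f {xs} y∈)

lose-concatMap : ∀ {X Y : Set} (f : X → List Y) {xs x y} → x ∈ xs → y ∈ f x → y ∈ concatMap f xs
lose-concatMap f x∈ y∈ = ∈-concatMap⁺ f (lose x∈ y∈)

when : ∀ {P X : Set} → Dec P → List X → List X
when (yes _) xs = xs
when (no  _) _  = []

∈-when⁻ : ∀ {P X : Set} (d : Dec P) {xs} {x : X} → x ∈ when d xs → P × x ∈ xs
∈-when⁻ (yes p) x∈ = p , x∈

∈-when⁺ : ∀ {P X : Set} (d : Dec P) {xs} {x : X} → P → x ∈ xs → x ∈ when d xs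
∈-when⁺ (yes _) _ x∈ = x∈
∈-when⁺ (no ¬p) p _  = contradiction p ¬p

drop-suc : ∀ {X : Set} j (xs : List X) {x s} → drop j xs ≡ x ∷ s → drop (suc j) xs ≡ s
drop-suc zero    (y ∷ xs) refl = refl
drop-suc (suc j) (y ∷ xs) eq   = drop-suc j xs eq

drop-∷⇒< : ∀ {X : Set} j (xs : List X) {x s} → drop j xs ≡ x ∷ s → j < length xs
drop-∷⇒< zero    (y ∷ xs) _  = s≤s z≤n
drop-∷⇒< (suc j) (y ∷ xs) eq = s≤s (drop-∷⇒< j xs eq)

focuses : ∀ {X : Set} → List X → List (List X × X × List X)
focuses []      = []
focuses (x ∷ s) = ([] , x , s) ∷ map (λ { (α , y , β) → x ∷ α , y , β }) (focuses s)

focuses⁻ : ∀ {X : Set} {s α x β} → (α , x , β) ∈ focuses {X} s → s ≡ α ++ x ∷ β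
focuses⁻ {s = x ∷ s} (here refl) = refl
focuses⁻ {s = x ∷ s} (there p∈) with ∈-map⁻ (λ { (α , y , β) → x ∷ α , y , β }) p∈
... | _ , p∈′ , refl = cong (x ∷_) (focuses⁻ p∈′)

focuses⁺ : ∀ {X : Set} α {x : X} {β} → (α , x , β) ∈ focuses (α ++ x ∷ β)
focuses⁺ []      = here refl
focuses⁺ (a ∷ α) = there (∈-map⁺ (λ { (α , y , β) → a ∷ α , y , β }) (focuses⁺ α))

module Derivations {A : Set} (G : CFG A) where
  open CFG G

  Symbol : Set
  Symbol = A ⊎ Fin N

  DerivesSeq-++ : ∀ {s t u v} → DerivesSeq G s u → DerivesSeq G t v → DerivesSeq G (s ++ t) (u ++ v)
  DerivesSeq-++ []ᵈ          dt = dt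
  DerivesSeq-++ (term a ds)  dt = term a (DerivesSeq-++ ds dt)
  DerivesSeq-++ {v = v} (nont {u = u₁} {v = u₂} d ds) dt =
    subst (DerivesSeq G _) (sym (++-assoc u₁ u₂ v)) (nont d (DerivesSeq-++ ds dt))

  Nullable : Symbol → Set
  Nullable (inj₁ _) = ⊥
  Nullable (inj₂ X) = Derives G X []

  Nullable⇒DerivesSeq-[] : ∀ {s} → All Nullable s → DerivesSeq G s []
  Nullable⇒DerivesSeq-[] []                    = []ᵈ
  Nullable⇒DerivesSeq-[] {inj₂ X ∷ _} (d ∷ ns) = nont d (Nullable⇒DerivesSeq-[] ns)

  Derives₁ : Symbol → List A → Set
  Derives₁ (inj₁ a) u = u ≡ a ∷ []
  Derives₁ (inj₂ X) u = Derives G X u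

  DerivesSeq-[x]⇒Derives₁ : ∀ {x u} → DerivesSeq G (x ∷ []) u → Derives₁ x u
  DerivesSeq-[x]⇒Derives₁ (term a []ᵈ)         = refl
  DerivesSeq-[x]⇒Derives₁ (nont {u = u} d []ᵈ) = subst (Derives G _) (sym (++-identityʳ u)) d

  Derives₁⇒DerivesSeq-[x] : ∀ {x u} → Derives₁ x u → DerivesSeq G (x ∷ []) u
  Derives₁⇒DerivesSeq-[x] {inj₁ a} refl = term a []ᵈ
  Derives₁⇒DerivesSeq-[x] {inj₂ X} {u} d = subst (DerivesSeq G _) (++-identityʳ u) (nont d []ᵈ)

module Binarisation {na : ℕ} (G : CFG (Fin na)) where
  open CFG G
  open Derivations G

  _≟Symbol_ : DecidableEquality Symbol
  _≟Symbol_ = ≡-dec-⊎ _≟Fin_ _≟Fin_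

  -- Chain X Y: X derives whatever Y derives, through unit rules X → α Z β with α, β nullable.
  Fact : Set
  Fact = Symbol ⊎ (Fin N × Fin N)

  pattern nullable x = inj₁ x
  pattern chain X Y  = inj₂ (X , Y)

  _≟Fact_ : DecidableEquality Fact
  _≟Fact_ = ≡-dec-⊎ _≟Symbol_ (≡-dec-× _≟Fin_ _≟Fin_)

  symbols : List Symbol
  symbols = map inj₁ (allFin na) ++ map inj₂ (allFin N)

  ∈-symbols : ∀ x → x ∈ symbols
  ∈-symbols (inj₁ a) = ∈-++⁺ˡ (∈-map⁺ inj₁ (∈-allFin a))
  ∈-symbols (inj₂ X) = ∈-++⁺ʳ (map inj₁ (allFin na)) (∈-map⁺ inj₂ (∈-allFin X))

  facts : List Fact
  facts = map inj₁ symbols ++ map inj₂ (cartesianProduct (allFin N) (allFin N))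

  ∈-facts : ∀ f → f ∈ facts
  ∈-facts (nullable x) = ∈-++⁺ˡ (∈-map⁺ inj₁ (∈-symbols x))
  ∈-facts (chain X Y)  =
    ∈-++⁺ʳ (map inj₁ symbols) (∈-map⁺ inj₂ (∈-cartesianProduct⁺ (∈-allFin X) (∈-allFin Y)))

  Clause : Set
  Clause = Fact × List Fact

  unitClauses : Fin N → List Symbol × Symbol × List Symbol → List Clause
  unitClauses X (α , inj₁ _ , β) = []
  unitClauses X (α , inj₂ Z , β) = map (λ Y → chain X Y , chain Z Y ∷ map nullable (α ++ β)) (allFin N)

  ruleClauses : Fin N × List Symbol → List Clause
  ruleClauses (X , rhs) = (nullable (inj₂ X) , map nullable rhs) ∷ concatMap (unitClauses X) (focuses rhs)

  reflClause : Fin N → Clause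
  reflClause X = chain X X , []

  clauses : List Clause
  clauses = map reflClause (allFin N) ++ concatMap ruleClauses rules

  open HornSaturation _≟Fact_ facts ∈-facts clauses

  data ClauseView : Fact → List Fact → Set where
    refl-chain : ∀ X → ClauseView (chain X X) []
    rule-nullable : ∀ {X rhs} → (X , rhs) ∈ rules → ClauseView (nullable (inj₂ X)) (map nullable rhs)
    unit-chain : ∀ {X α Z β} Y → (X , α ++ inj₂ Z ∷ β) ∈ rules →
                 ClauseView (chain X Y) (chain Z Y ∷ map nullable (α ++ β))

  clauseView : ∀ {f ps} → (f , ps) ∈ clauses → ClauseView f ps
  clauseView c∈ with ∈-++⁻ (map reflClause (allFin N)) c∈
  ... | inj₁ c∈refl with ∈-map⁻ reflClause c∈refl
  ...   | X , _ , refl = refl-chain X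
  clauseView c∈ | inj₂ c∈rule with find-concatMap ruleClauses rules c∈rule
  ... | (X , rhs) , r∈ , here refl = rule-nullable r∈
  ... | (X , rhs) , r∈ , there c∈unit with find-concatMap (unitClauses X) (focuses rhs) c∈unit
  ...   | (α , inj₂ Z , β) , p∈ , c∈′ with ∈-map⁻ (λ Y → chain X Y , chain Z Y ∷ map nullable (α ++ β)) c∈′
  ...     | Y , _ , refl = unit-chain Y (subst (λ rhs → (X , rhs) ∈ rules) (focuses⁻ p∈) r∈)

  mutual
    Derivable⇒Nullable : ∀ {x} → Derivable (nullable x) → Nullable x
    Derivable⇒Nullable (derive c∈ ds) with clauseView c∈
    ... | rule-nullable r∈ = rule r∈ (Nullable⇒DerivesSeq-[] (all-Derivable⇒Nullable ds))

    all-Derivable⇒Nullable : ∀ {s} → All Derivable (map nullable s) → All Nullable s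
    all-Derivable⇒Nullable {[]}    []       = []
    all-Derivable⇒Nullable {x ∷ s} (d ∷ ds) = Derivable⇒Nullable d ∷ all-Derivable⇒Nullable ds

  mutual
    Nullable⇒Derivable : ∀ {x} → Nullable x → Derivable (nullable x)
    Nullable⇒Derivable {inj₂ X} (rule r∈ ds) =
      derive (∈-++⁺ʳ (map reflClause (allFin N)) (lose-concatMap ruleClauses r∈ (here refl)))
             (AllP.map⁺ (DerivesSeq-[]⇒Derivable ds refl))

    DerivesSeq-[]⇒Derivable : ∀ {s w} → DerivesSeq G s w → w ≡ [] → All (λ x → Derivable (nullable x)) s
    DerivesSeq-[]⇒Derivable []ᵈ                  _  = []
    DerivesSeq-[]⇒Derivable (nont {u = []} d ds) eq = Nullable⇒Derivable d ∷ DerivesSeq-[]⇒Derivable ds eq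

  nullable? : ∀ x → Dec (Nullable x)
  nullable? x = map′ Derivable⇒Nullable Nullable⇒Derivable (derivable? (nullable x))

  Chain : Fin N → Fin N → Set
  Chain X Y = Derivable (chain X Y)

  chain? : ∀ X Y → Dec (Chain X Y)
  chain? X Y = derivable? (chain X Y)

  Chain-refl : ∀ X → Chain X X
  Chain-refl X = derive (∈-++⁺ˡ (∈-map⁺ reflClause (∈-allFin X))) []

  Chain-unit : ∀ {X α Z β Y} → (X , α ++ inj₂ Z ∷ β) ∈ rules → All Nullable α → All Nullable β →
               Chain Z Y → Chain X Y
  Chain-unit {X} {α} {Z} {β} {Y} r∈ nα nβ ch =
    derive (∈-++⁺ʳ (map reflClause (allFin N)) (lose-concatMap ruleClauses r∈ (there
             (lose-concatMap (unitClauses X) (focuses⁺ α)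
               (∈-map⁺ (λ Y → chain X Y , chain Z Y ∷ map nullable (α ++ β)) (∈-allFin Y))))))
           (ch ∷ AllP.map⁺ (All.map Nullable⇒Derivable (AllP.++⁺ nα nβ)))

  Chain-sound : ∀ {X Y w} → Chain X Y → Derives G Y w → Derives G X w
  Chain-sound (derive c∈ ds) d with clauseView c∈
  Chain-sound (derive c∈ []) d | refl-chain X = d
  Chain-sound {w = w} (derive c∈ (ch ∷ ds)) d | unit-chain {X} {α} {Z} {β} Y r∈ =
    rule r∈ (DerivesSeq-++ (Nullable⇒DerivesSeq-[] nα)
              (subst (DerivesSeq G _) (++-identityʳ w)
                (DerivesSeq-++ {s = inj₂ Z ∷ []} (Derives₁⇒DerivesSeq-[x] (Chain-sound ch d))
                               (Nullable⇒DerivesSeq-[] nβ))))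
    where
    nαβ = all-Derivable⇒Nullable ds
    nα = AllP.++⁻ˡ α nαβ
    nβ = AllP.++⁻ʳ α nαβ

  K : ℕ
  K = length rules

  lhs : Fin K → Fin N
  lhs k = proj₁ (lookup rules k)

  rhs : Fin K → List Symbol
  rhs k = proj₂ (lookup rules k)

  rule-index : ∀ {X r} → (X , r) ∈ rules → ∃ λ k → lhs k ≡ X × rhs k ≡ r
  rule-index r∈ = index r∈ , cong proj₁ (sym (lookup-index r∈)) , cong proj₂ (sym (lookup-index r∈))

  -- suffix k j stands for drop j (rhs k), yielding only words with two or more non-vanishing
  -- symbols; the other derivations are absorbed into leaves and branches via Nullable and Chain.
  data Sym : Set where
    nt     : Fin N → Sym
    tm     : Fin na → Sym
    suffix : Fin K → ℕ → Sym

  ⟦_⟧ : Sym → List Symbol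
  ⟦ nt X ⟧       = inj₂ X ∷ []
  ⟦ tm a ⟧       = inj₁ a ∷ []
  ⟦ suffix k j ⟧ = drop j (rhs k)

  single : Symbol → Sym
  single (inj₁ a) = tm a
  single (inj₂ X) = nt X

  ⟦single⟧ : ∀ x → ⟦ single x ⟧ ≡ x ∷ []
  ⟦single⟧ (inj₁ _) = refl
  ⟦single⟧ (inj₂ _) = refl

  code : Sym → List ℕ
  code (nt X)       = 0 ∷ toℕ X ∷ 0 ∷ []
  code (tm a)       = 1 ∷ toℕ a ∷ 0 ∷ []
  code (suffix k j) = 2 ∷ toℕ k ∷ j ∷ []

  code-length : ∀ s s′ → length (code s) ≡ length (code s′)
  code-length (nt _)       (nt _)       = refl
  code-length (nt _)       (tm _)       = refl
  code-length (nt _)       (suffix _ _) = refl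
  code-length (tm _)       (nt _)       = refl
  code-length (tm _)       (tm _)       = refl
  code-length (tm _)       (suffix _ _) = refl
  code-length (suffix _ _) (nt _)       = refl
  code-length (suffix _ _) (tm _)       = refl
  code-length (suffix _ _) (suffix _ _) = refl

  private
    second : ∀ {X : Set} {x x′ y y′ : X} {xs ys : List X} →
             _≡_ {A = List X} (x ∷ y ∷ xs) (x′ ∷ y′ ∷ ys) → y ≡ y′
    second refl = refl

    third : ∀ {X : Set} {x x′ y y′ z z′ : X} {xs ys : List X} →
            _≡_ {A = List X} (x ∷ y ∷ z ∷ xs) (x′ ∷ y′ ∷ z′ ∷ ys) → z ≡ z′
    third refl = refl

  code-injective : ∀ {s s′} → code s ≡ code s′ → s ≡ s′
  code-injective {nt _}       {nt _}       eq = cong nt (toℕ-injective (second eq))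
  code-injective {tm _}       {tm _}       eq = cong tm (toℕ-injective (second eq))
  code-injective {suffix _ _} {suffix _ _} eq = cong₂ suffix (toℕ-injective (second eq)) (third eq)
  code-injective {nt _}       {tm _}       ()
  code-injective {nt _}       {suffix _ _} ()
  code-injective {tm _}       {nt _}       ()
  code-injective {tm _}       {suffix _ _} ()
  code-injective {suffix _ _} {nt _}       ()
  code-injective {suffix _ _} {tm _}       ()

  _≟Sym_ : DecidableEquality Sym
  s ≟Sym s′ = map′ code-injective (cong code) (≡-dec _≟ℕ_ (code s) (code s′))

  Lone : List Symbol × Symbol × List Symbol → Set
  Lone (β , _ , γ) = All Nullable β × All Nullable γ

  lone? : ∀ p → Dec (Lone p)
  lone? (β , _ , γ) = all? nullable? β ×-dec all? nullable? γ

  loneSymbols : List Symbol → List Symbol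
  loneSymbols s = map (λ p → proj₁ (proj₂ p)) (filter lone? (focuses s))

  ∈-loneSymbols⁻ : ∀ {s y} → y ∈ loneSymbols s →
                   ∃₂ λ β γ → s ≡ β ++ y ∷ γ × All Nullable β × All Nullable γ
  ∈-loneSymbols⁻ y∈ with ∈-map⁻ (λ p → proj₁ (proj₂ p)) y∈
  ... | (β , y , γ) , p∈ , refl with ∈-filter⁻ lone? p∈
  ...   | p∈′ , nβ , nγ = β , γ , focuses⁻ p∈′ , nβ , nγ

  ∈-loneSymbols⁺ : ∀ {β y γ} → All Nullable β → All Nullable γ → y ∈ loneSymbols (β ++ y ∷ γ)
  ∈-loneSymbols⁺ {β} nβ nγ =
    ∈-map⁺ (λ p → proj₁ (proj₂ p)) (∈-filter⁺ lone? (focuses⁺ β) (nβ , nγ))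

  -- the pairs l r of the binary rules suffix k j → l r, where s = drop j (rhs k)
  pairRules : Fin K → ℕ → List Symbol → List (Sym × Sym)
  pairRules k j []      = []
  pairRules k j (x ∷ s) =
    ((single x , suffix k (suc j)) ∷ map (λ y → single x , single y) (loneSymbols s)) ++
    when (nullable? x) (pairRules k (suc j) s)

  pairRules-skip : ∀ {k j x s p} → Nullable x → p ∈ pairRules k (suc j) s → p ∈ pairRules k j (x ∷ s)
  pairRules-skip {k} {j} {x} {s} nx p∈ =
    ∈-++⁺ʳ ((single x , suffix k (suc j)) ∷ map (λ y → single x , single y) (loneSymbols s))
           (∈-when⁺ (nullable? x) nx p∈)

  chainsInto? : (p : Fin N × Fin K) → Dec (Chain (proj₁ p) (lhs (proj₂ p)))
  chainsInto? (X , k) = chain? X (lhs k)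

  chainedRules : List (Fin N × Fin K)
  chainedRules = filter chainsInto? (cartesianProduct (allFin N) (allFin K))

  ∈-chainedRules⁻ : ∀ {X k} → (X , k) ∈ chainedRules → Chain X (lhs k)
  ∈-chainedRules⁻ p∈ = proj₂ (∈-filter⁻ chainsInto? {xs = cartesianProduct (allFin N) (allFin K)} p∈)

  ∈-chainedRules⁺ : ∀ {X k} → Chain X (lhs k) → (X , k) ∈ chainedRules
  ∈-chainedRules⁺ {X} {k} = ∈-filter⁺ chainsInto? (∈-cartesianProduct⁺ (∈-allFin X) (∈-allFin k))

  terminalLeaf : Fin N → Symbol → List (Sym × Fin na)
  terminalLeaf X (inj₁ a) = (nt X , a) ∷ []
  terminalLeaf X (inj₂ _) = []

  chainedLeaves : Fin N × Fin K → List (Sym × Fin na)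
  chainedLeaves (X , k) = concatMap (terminalLeaf X) (loneSymbols (rhs k))

  leaves : List (Sym × Fin na)
  leaves = map (λ a → tm a , a) (allFin na) ++ concatMap chainedLeaves chainedRules

  chainedBranches : Fin N × Fin K → List (Sym × Sym × Sym)
  chainedBranches (X , k) = map (nt X ,_) (pairRules k 0 (rhs k))

  suffixBranchesAt : Fin K → ℕ → List (Sym × Sym × Sym)
  suffixBranchesAt k j = map (suffix k j ,_) (pairRules k j (drop j (rhs k)))

  suffixBranches : Fin K → List (Sym × Sym × Sym)
  suffixBranches k = concatMap (suffixBranchesAt k) (upTo (length (rhs k)))

  branches : List (Sym × Sym × Sym)
  branches = concatMap chainedBranches chainedRules ++ concatMap suffixBranches (allFin K)

  data LeafView : Sym → Fin na → Set where
    tm-leaf : ∀ a → LeafView (tm a) a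
    nt-leaf : ∀ {X k a} → Chain X (lhs k) → inj₁ a ∈ loneSymbols (rhs k) → LeafView (nt X) a

  leafView : ∀ {s a} → (s , a) ∈ leaves → LeafView s a
  leafView l∈ with ∈-++⁻ (map (λ a → tm a , a) (allFin na)) l∈
  ... | inj₁ l∈tm with ∈-map⁻ (λ a → tm a , a) l∈tm
  ...   | a , _ , refl = tm-leaf a
  leafView l∈ | inj₂ l∈nt with find-concatMap chainedLeaves chainedRules l∈nt
  ... | (X , k) , p∈ , l∈′ with find-concatMap (terminalLeaf X) (loneSymbols (rhs k)) l∈′
  ...   | inj₁ a , a∈ , here refl = nt-leaf (∈-chainedRules⁻ p∈) a∈

  nt-leaf∈ : ∀ {X k a} → Chain X (lhs k) → inj₁ a ∈ loneSymbols (rhs k) → (nt X , a) ∈ leaves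
  nt-leaf∈ {X} {k} ch a∈ =
    ∈-++⁺ʳ (map (λ a → tm a , a) (allFin na))
      (lose-concatMap chainedLeaves (∈-chainedRules⁺ ch) (lose-concatMap (terminalLeaf X) a∈ (here refl)))

  tm-leaf∈ : ∀ a → (tm a , a) ∈ leaves
  tm-leaf∈ a = ∈-++⁺ˡ (∈-map⁺ (λ a → tm a , a) (∈-allFin a))

  data BranchView : Sym → Sym → Sym → Set where
    nt-branch     : ∀ {X k l r} → Chain X (lhs k) → (l , r) ∈ pairRules k 0 (rhs k) → BranchView (nt X) l r
    suffix-branch : ∀ {k j l r} → (l , r) ∈ pairRules k j (drop j (rhs k)) → BranchView (suffix k j) l r

  branchView : ∀ {s l r} → (s , l , r) ∈ branches → BranchView s l r
  branchView b∈ with ∈-++⁻ (concatMap chainedBranches chainedRules) b∈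
  ... | inj₁ b∈nt with find-concatMap chainedBranches chainedRules b∈nt
  ...   | (X , k) , p∈ , b∈′ with ∈-map⁻ (nt X ,_) b∈′
  ...     | _ , lr∈ , refl = nt-branch (∈-chainedRules⁻ p∈) lr∈
  branchView b∈ | inj₂ b∈suffix with find-concatMap suffixBranches (allFin K) b∈suffix
  ... | k , _ , b∈′ with find-concatMap (suffixBranchesAt k) (upTo (length (rhs k))) b∈′
  ...   | j , _ , b∈″ with ∈-map⁻ (suffix k j ,_) b∈″
  ...     | _ , lr∈ , refl = suffix-branch lr∈

  nt-branch∈ : ∀ {X k l r} → Chain X (lhs k) → (l , r) ∈ pairRules k 0 (rhs k) →
               (nt X , l , r) ∈ branches
  nt-branch∈ {X} ch lr∈ =
    ∈-++⁺ˡ (lose-concatMap chainedBranches (∈-chainedRules⁺ ch) (∈-map⁺ (nt X ,_) lr∈))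

  suffix-branch∈ : ∀ {k j l r} → j < length (rhs k) → (l , r) ∈ pairRules k j (drop j (rhs k)) →
                   (suffix k j , l , r) ∈ branches
  suffix-branch∈ {k} {j} j< lr∈ =
    ∈-++⁺ʳ (concatMap chainedBranches chainedRules)
      (lose-concatMap suffixBranches (∈-allFin k)
        (lose-concatMap (suffixBranchesAt k) (∈-upTo⁺ j<)
          (∈-map⁺ (suffix k j ,_) lr∈)))

  open BinaryGrammar leaves branches

  pairRules-sound : ∀ k j s {l r u v} → drop j (rhs k) ≡ s → (l , r) ∈ pairRules k j s →
    DerivesSeq G ⟦ l ⟧ u → DerivesSeq G ⟦ r ⟧ v → DerivesSeq G s (u ++ v)
  pairRules-sound k j (x ∷ s) eq (here refl) dl dr =
    DerivesSeq-++ {s = x ∷ []} (subst (λ s → DerivesSeq G s _) (⟦single⟧ x) dl)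
                               (subst (λ s → DerivesSeq G s _) (drop-suc j (rhs k) eq) dr)
  pairRules-sound k j (x ∷ s) {v = v} eq (there p∈) dl dr
    with ∈-++⁻ (map (λ y → single x , single y) (loneSymbols s)) p∈
  ... | inj₁ p∈lone with ∈-map⁻ (λ y → single x , single y) p∈lone
  ...   | y , y∈ , refl with ∈-loneSymbols⁻ {s} y∈
  ...     | β , γ , refl , nβ , nγ =
    DerivesSeq-++ {s = x ∷ []} (subst (λ s → DerivesSeq G s _) (⟦single⟧ x) dl)
      (DerivesSeq-++ (Nullable⇒DerivesSeq-[] nβ)
        (subst (DerivesSeq G _) (++-identityʳ v)
          (DerivesSeq-++ {s = y ∷ []} (subst (λ s → DerivesSeq G s _) (⟦single⟧ y) dr)
                                      (Nullable⇒DerivesSeq-[] nγ))))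
  pairRules-sound k j (x ∷ s) eq (there p∈) dl dr | inj₂ p∈skip with ∈-when⁻ (nullable? x) p∈skip
  ... | nx , p∈′ =
    DerivesSeq-++ {u = []} (Nullable⇒DerivesSeq-[] (nx ∷ []))
      (pairRules-sound k (suc j) s (drop-suc j (rhs k) eq) p∈′ dl dr)

  ruleAt : ∀ k {w} → DerivesSeq G (rhs k) w → Derives G (lhs k) w
  ruleAt k = rule (∈-lookup k)

  Yields-sound : ∀ {s w} → Yields s w → DerivesSeq G ⟦ s ⟧ w
  Yields-sound (leaf l∈) with leafView l∈
  ... | tm-leaf a = term a []ᵈ
  ... | nt-leaf {k = k} {a} ch a∈ with ∈-loneSymbols⁻ a∈
  ...   | β , γ , eq , nβ , nγ =
    Derives₁⇒DerivesSeq-[x] (Chain-sound ch (ruleAt k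
      (subst (λ s → DerivesSeq G s _) (sym eq)
        (DerivesSeq-++ (Nullable⇒DerivesSeq-[] nβ) (term a (Nullable⇒DerivesSeq-[] nγ))))))
  Yields-sound (branch b∈ y₁ y₂) with branchView b∈
  ... | nt-branch {k = k} ch lr∈ =
    Derives₁⇒DerivesSeq-[x] (Chain-sound ch (ruleAt k
      (pairRules-sound k 0 (rhs k) refl lr∈ (Yields-sound y₁) (Yields-sound y₂))))
  ... | suffix-branch {k} {j} lr∈ = pairRules-sound k j _ refl lr∈ (Yields-sound y₁) (Yields-sound y₂)

  data SuffixShape (k : Fin K) (j : ℕ) (s : List Symbol) (w : List (Fin na)) : Set where
    vanishes : w ≡ [] → All Nullable s → SuffixShape k j s w
    lone     : ∀ {β y γ} → s ≡ β ++ y ∷ γ → All Nullable β → All Nullable γ → Yields (single y) w →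
               SuffixShape k j s w
    pair     : ∀ {l r u v} → (l , r) ∈ pairRules k j s → Yields l u → Yields r v → w ≡ u ++ v →
               SuffixShape k j s w

  tm-Yields⁻ : ∀ {a w} → Yields (tm a) w → w ≡ a ∷ []
  tm-Yields⁻ (leaf l∈) with leafView l∈
  ... | tm-leaf a = refl
  tm-Yields⁻ (branch b∈ _ _) with branchView b∈
  ... | ()

  Yields-unit : ∀ {X β Z γ w} → (X , β ++ inj₂ Z ∷ γ) ∈ rules → All Nullable β → All Nullable γ →
                Yields (nt Z) w → Yields (nt X) w
  Yields-unit r∈ nβ nγ (leaf l∈) with leafView l∈
  ... | nt-leaf ch a∈ = leaf (nt-leaf∈ (Chain-unit r∈ nβ nγ ch) a∈)
  Yields-unit r∈ nβ nγ (branch b∈ y₁ y₂) with branchView b∈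
  ... | nt-branch ch lr∈ = branch (nt-branch∈ (Chain-unit r∈ nβ nγ ch) lr∈) y₁ y₂

  shape-skip : ∀ {k j x s v} → Nullable x → SuffixShape k (suc j) s v → SuffixShape k j (x ∷ s) v
  shape-skip nx (vanishes eq ns)            = vanishes eq (nx ∷ ns)
  shape-skip nx (lone eq nβ nγ y)           = lone (cong (_ ∷_) eq) (nx ∷ nβ) nγ y
  shape-skip {s = s} nx (pair lr∈ y₁ y₂ eq) = pair (pairRules-skip {s = s} nx lr∈) y₁ y₂ eq

  shape-keep : ∀ {k j x s u v} → drop j (rhs k) ≡ x ∷ s →
               Yields (single x) u → SuffixShape k (suc j) s v → SuffixShape k j (x ∷ s) (u ++ v)
  shape-keep {u = u} _ y (vanishes refl ns) = lone {β = []} refl [] ns (subst (Yields _) (sym (++-identityʳ u)) y)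
  shape-keep {x = x} _ y (lone refl nβ nγ y′) =
    pair (there (∈-++⁺ˡ (∈-map⁺ (λ y → single x , single y) (∈-loneSymbols⁺ nβ nγ)))) y y′ refl
  shape-keep {s = []} _ _ (pair () _ _ _)
  shape-keep {k} {j} {s = _ ∷ _} eq y (pair lr∈ y₁ y₂ refl) =
    pair (here refl) y (branch (suffix-branch∈ (drop-∷⇒< (suc j) (rhs k) eq′) lr∈′) y₁ y₂) refl
    where
    eq′ = drop-suc j (rhs k) eq
    lr∈′ = subst (λ s → _ ∈ pairRules k (suc j) s) (sym eq′) lr∈

  mutual
    Derives⇒Yields : ∀ {X w} → Derives G X w → w ≢ [] → Yields (nt X) w
    Derives⇒Yields (rule r∈ ds) w≢[] with rule-index r∈
    ... | k , refl , refl with shape {k} {0} refl ds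
    ...   | vanishes eq _ = contradiction eq w≢[]
    ...   | lone {y = inj₁ a} eq nβ nγ y rewrite tm-Yields⁻ y =
      leaf (nt-leaf∈ (Chain-refl _)
                     (subst (λ s → inj₁ a ∈ loneSymbols s) (sym eq) (∈-loneSymbols⁺ nβ nγ)))
    ...   | lone {y = inj₂ Z} eq nβ nγ y = Yields-unit (subst (λ s → (lhs k , s) ∈ rules) eq r∈) nβ nγ y
    ...   | pair lr∈ y₁ y₂ refl = branch (nt-branch∈ (Chain-refl _) lr∈) y₁ y₂

    shape : ∀ {k j s w} → drop j (rhs k) ≡ s → DerivesSeq G s w → SuffixShape k j s w
    shape eq []ᵈ = vanishes refl []
    shape {k} {j} eq (term a ds) = shape-keep eq (leaf (tm-leaf∈ a)) (shape (drop-suc j (rhs k) eq) ds)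
    shape {k} {j} eq (nont {u = []} d ds) = shape-skip d (shape (drop-suc j (rhs k) eq) ds)
    shape {k} {j} eq (nont {u = _ ∷ _} d ds) =
      shape-keep eq (Derives⇒Yields d (λ ())) (shape (drop-suc j (rhs k) eq) ds)

  Language⇒ : ∀ {w} → Language G w → (w ≡ [] × Derives G start []) ⊎ Yields (nt start) w
  Language⇒ {[]}    d = inj₁ (refl , d)
  Language⇒ {_ ∷ _} d = inj₂ (Derives⇒Yields d (λ ()))

  Language⇐ : ∀ {w} → (w ≡ [] × Derives G start []) ⊎ Yields (nt start) w → Language G w
  Language⇐ (inj₁ (refl , d)) = d
  Language⇐ (inj₂ y)          = DerivesSeq-[x]⇒Derives₁ (Yields-sound y)

  Language⇔ : ∀ w → Language G w ⇔ ((w ≡ [] × Derives G start []) ⊎ Yields (nt start) w)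
  Language⇔ w = mk⇔ Language⇒ Language⇐

2≤n⇒distinct : ∀ {n} → 2 ≤ n → ∃₂ λ (i j : Fin n) → i ≢ j
2≤n⇒distinct (s≤s (s≤s z≤n)) = zero , suc zero , λ ()

theorem6 : ∀ {c ℓ m ℓm : Level}
    (R : Semiring c ℓ) (B : LeftSemimodule R m ℓm)
    → FinitelyGeneratedSemiring R
    → FinitelyGeneratedModule B
    → Idempotent R
    → (n : ℕ) → 2 ≤ n
    → (φ : MonoidMorphism R (Ω n))
    → (b₀ b₁ : LeftSemimodule.Carrierᴹ B)
    → (∀ w → (_≤ᴮ_ B b₁ (LeftSemimodule._*ₗ_ B (MonoidMorphism.α φ w) b₀)) ⇔ Dyck w)
    → PrimeElement B b₁
    → (a : ℕ) (L : List (Fin a) → Set)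
    → ContextFree L
    → Σ ℕ λ k → Σ (Automaton B (Fin a) k) λ M → RecognizesBy B M L b₁
theorem6 R B _ _ _ n 2≤n φ b₀ b₁ Dyck⇔ prime a L (G , L⇔) with 2≤n⇒distinct 2≤n
... | i , j , i≢j =
  3 , automaton dyckTransducer , initial , λ w →
    ⇔-trans (L⇔ w) (⇔-trans (Language⇔ w)
      (⇔-trans (Yields⇔translates-Dyck w) (⇔-sym (recognises dyckTransducer initial w))))
  where
  open CFG G using (start)
  open Binarisation G
  open DyckRecognition {n} using (¬Dyck-close)
  open SemimoduleOrder B using (≤0⇒≤)

  b₁≰0 : ¬ _≤ᴮ_ B b₁ (LeftSemimodule.0ᴹ B)
  b₁≰0 b₁≤0 = ¬Dyck-close {i} (Equivalence.to (Dyck⇔ _) (≤0⇒≤ b₁≤0))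

  open WeightedRecognition B φ Dyck b₀ b₁ Dyck⇔ b₁≰0 prime
  open ChomskySchützenberger _≟Fin_ _≟Sym_ leaves branches (nt start) (nullable? (inj₂ start))
  open Encoded i j i≢j code code-length code-injective
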